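{- Let $x>1$ be a half integer and let $C = \frac{1284699552}{444215525} = 2.89206\ldots$. (a) Let $p_{ -8} < p_{ -7} < \cdots < p_{ -1} < x$ denote the largest eight primes in the interval $(\frac{x}{2},x)$ (those that exist). Then \[ F_1(x) = \sum_{1 \leq n \leq 8} \frac{1}{x-p_{ -n}} \leq C, \] where a summand is taken to be zero if the corresponding prime $p_{ -n}$ does not exist; and this bound is sharp (attained for some such $x$). (b) Let $x<p_1 <p_2<\cdots < p_8$ denote the smallest eight primes in the interval $(x,\frac{3x}{2})$ (those that exist). Then \[ F_2(x) = \sum_{1 \leq n \leq 8} \frac{1}{p_n -x} \leq C, \] where a summand is taken to be zero if the corresponding prime $p_n$ does not exist; and this bound is sharp (attained for some such $x$).
   Context: A half integer means an element of $\{\tfrac32,\tfrac52,\tfrac72,\ldots\}$. -}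

module Defs where

open import Data.Nat as ℕ using (ℕ; suc; _≤_)
open import Data.Nat.Primality using (Prime; prime?)
open import Data.Integer as ℤ using (+_)
open import Data.Rational using (ℚ; _/_; _+_; _-_; _*_; 1/_; 0ℚ; _<_; ≢-nonZero; ceiling)
open import Data.Rational.Properties using (_≟_; _<?_)
open import Data.List using (List; filter; take; upTo; downFrom; map; foldr)
open import Data.Product using (Σ; _×_; ∃-syntax)
open import Relation.Binary.PropositionalEquality using (_≡_)
open import Relation.Nullary using (yes; no)
open import Relation.Nullary.Decidable using (_×-dec_)

ℕ→ℚ : ℕ → ℚ
ℕ→ℚ n = + n / 1

HalfInteger : ℚ → Set
HalfInteger x = ∃[ m ] (1 ≤ m × x ≡ + (2 ℕ.* m ℕ.+ 1) / 2)

-- reciprocal, with the (never used) convention 1/0 = 0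
recip : ℚ → ℚ
recip q with q ≟ 0ℚ
... | yes _ = 0ℚ
... | no q≢0 = 1/_ q {{≢-nonZero q≢0}}

-- a natural-number bound N(x) = |⌈2x⌉|; every prime below 3x/2 is ≤ N(x) for x > 0
bound : ℚ → ℕ
bound x = ℤ.∣ ceiling (x * (+ 2 / 1)) ∣

primesLowerDesc : ℚ → List ℕ
primesLowerDesc x =
  filter (λ p → prime? p ×-dec ((x * (+ 1 / 2)) <? ℕ→ℚ p) ×-dec (ℕ→ℚ p <? x))
         (downFrom (suc (bound x)))

primesUpperAsc : ℚ → List ℕ
primesUpperAsc x =
  filter (λ p → prime? p ×-dec (x <? ℕ→ℚ p) ×-dec (ℕ→ℚ p <? (x * (+ 3 / 2))))
         (upTo (suc (bound x)))

sumℚ : List ℚ → ℚ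
sumℚ = foldr _+_ 0ℚ

F₁ : ℚ → ℚ
F₁ x = sumℚ (map (λ p → recip (x - ℕ→ℚ p)) (take 8 (primesLowerDesc x)))

F₂ : ℚ → ℚ
F₂ x = sumℚ (map (λ p → recip (ℕ→ℚ p - x)) (take 8 (primesUpperAsc x)))

C : ℚ
C = + 1284699552 / 444215525

-- Write x = m + 1/2. A prime p in (x/2, x) or (x, 3x/2) lies at distance e + 1/2 from x for a
-- natural number e, its gap, and contributes 2/(2e+1), which decreases in e. For m ≥ 14 all these
-- primes exceed 7, hence are coprime to 210, which rules out the gaps in certain residue classes
-- determined by m mod 210. Distinct primes have distinct gaps, so F₁ and F₂ are at most the sum
-- of 2/(2e+1) over the eight smallest admissible gaps, and this greedy bound is at most C for
-- each of the 210 residues. The cases m < 14 and the extremal points x = 88819.5 and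
-- x = 15760090.5 are computed.

module Submission where

open import Algebra.Properties.AbelianGroup using (xyx⁻¹≈y)
open import Data.Bool using (Bool; true; false; T; if_then_else_; _∧_)
open import Data.Bool.Properties using (T-∧)
open import Data.Integer as ℤ using (+_)
import Data.Integer.Properties as ℤ
open import Data.List using (List; []; _∷_; map; length; take; filter; downFrom; applyUpTo)
import Data.List.Properties as List
open import Data.List.Relation.Unary.All as All using (All; []; _∷_)
import Data.List.Relation.Unary.All.Properties as All
open import Data.List.Relation.Unary.AllPairs using (AllPairs; []; _∷_)
import Data.List.Relation.Unary.AllPairs.Properties as AllPairs
open import Data.Nat as ℕ
  using (ℕ; zero; suc; _+_; _*_; _∸_; _%_; _/_; _≤_; _<_; _>_; z≤n; s≤s; NonZero; NonTrivial)
import Data.Nat.Properties as ℕ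
open import Data.Nat.DivMod using (m≡m%n+[m/n]*n; %-distribˡ-+; m∣n⇒o%n%m≡o%m; m*n%n≡0; m%n<n)
open import Data.Nat.Divisibility
  using (_∣_; divides; hasNonTrivialDivisor; _∣?_; ∣m+n∣m⇒∣n; n∣m*n; m%n≡0⇒n∣m)
open import Data.Nat.Primality
  using (Prime; prime?; _Rough_; 2-rough; ∤⇒rough-suc; rough∧square>⇒prime; prime⇒¬composite)
open import Data.Nat.Tactic.RingSolver using (solve-∀)
open import Data.Product using (_×_; _,_; ∃-syntax)
open import Data.Rational as ℚ using (ℚ; 1/_; 0ℚ; 1ℚ; toℚᵘ)
import Data.Rational.Properties as ℚ
import Data.Rational.Unnormalised as ℚᵘ
import Data.Rational.Unnormalised.Properties as ℚᵘ
open import Data.Sum using (inj₁; inj₂; [_,_]′)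
open import Function using (_∘_; id; Equivalence)
open import Relation.Binary.PropositionalEquality
open import Relation.Nullary using (¬_; Dec; yes; no; isNo; contradiction)
open import Relation.Nullary.Decidable using (_×-dec_; fromWitnessFalse; from-yes)
open import Relation.Unary using (Pred; Decidable)
open import Level using (0ℓ)
open import Defs

private
  toℚᵘ-/ : ∀ i k → toℚᵘ (i ℚ./ suc k) ℚᵘ.≃ ℚᵘ.mkℚᵘ i k
  toℚᵘ-/ i k = ℚ.toℚᵘ-fromℚᵘ (ℚᵘ.mkℚᵘ i k)

  +-* : ∀ a b → + a ℤ.* + b ≡ + (a * b)
  +-* a b = sym (ℤ.pos-* a b)

/≡/ : ∀ a b k l → a * suc l ≡ b * suc k → + a ℚ./ suc k ≡ + b ℚ./ suc l
/≡/ a b k l eq = ℚ.toℚᵘ-injective (ℚᵘ.≃-trans (toℚᵘ-/ (+ a) k)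
  (ℚᵘ.≃-trans (ℚᵘ.*≡* (trans (+-* a (suc l)) (trans (cong +_ eq) (sym (+-* b (suc k))))))
  (ℚᵘ.≃-sym (toℚᵘ-/ (+ b) l))))

/+/ : ∀ a b k l → + a ℚ./ suc k ℚ.+ + b ℚ./ suc l ≡ + (a * suc l + b * suc k) ℚ./ (suc k * suc l)
/+/ a b k l = ℚ.toℚᵘ-injective
  (ℚᵘ.≃-trans (ℚ.toℚᵘ-homo-+ (+ a ℚ./ suc k) (+ b ℚ./ suc l))
  (ℚᵘ.≃-trans (ℚᵘ.+-cong (toℚᵘ-/ (+ a) k) (toℚᵘ-/ (+ b) l))
  (ℚᵘ.≃-trans (ℚᵘ.*≡* (cong (ℤ._* + (suc k * suc l)) numerator))
  (ℚᵘ.≃-sym (toℚᵘ-/ (+ (a * suc l + b * suc k)) _)))))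
  where
  numerator : + a ℤ.* + suc l ℤ.+ + b ℤ.* + suc k ≡ + (a * suc l + b * suc k)
  numerator = cong₂ ℤ._+_ (+-* a (suc l)) (+-* b (suc k))

/*/ : ∀ a b k l → (+ a ℚ./ suc k) ℚ.* (+ b ℚ./ suc l) ≡ + (a * b) ℚ./ (suc k * suc l)
/*/ a b k l = ℚ.toℚᵘ-injective
  (ℚᵘ.≃-trans (ℚ.toℚᵘ-homo-* (+ a ℚ./ suc k) (+ b ℚ./ suc l))
  (ℚᵘ.≃-trans (ℚᵘ.*-cong (toℚᵘ-/ (+ a) k) (toℚᵘ-/ (+ b) l))
  (ℚᵘ.≃-trans (ℚᵘ.*≡* (cong (ℤ._* + (suc k * suc l)) (+-* a b)))
  (ℚᵘ.≃-sym (toℚᵘ-/ (+ (a * b)) _)))))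

/≤/ : ∀ a b k l → a * suc l ≤ b * suc k → + a ℚ./ suc k ℚ.≤ + b ℚ./ suc l
/≤/ a b k l le = ℚ.toℚᵘ-cancel-≤
  (ℚᵘ.≤-respˡ-≃ (ℚᵘ.≃-sym (toℚᵘ-/ (+ a) k)) (ℚᵘ.≤-respʳ-≃ (ℚᵘ.≃-sym (toℚᵘ-/ (+ b) l))
  (ℚᵘ.*≤* (subst₂ ℤ._≤_ (sym (+-* a (suc l))) (sym (+-* b (suc k))) (ℤ.+≤+ le)))))

/</⁻¹ : ∀ a b k l → + a ℚ./ suc k ℚ.< + b ℚ./ suc l → a * suc l < b * suc k
/</⁻¹ a b k l lt with ℚᵘ.<-respˡ-≃ (toℚᵘ-/ (+ a) k) (ℚᵘ.<-respʳ-≃ (toℚᵘ-/ (+ b) l) (ℚ.toℚᵘ-mono-< lt))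
... | ℚᵘ.*<* lt′ = ℤ.drop‿+<+ (subst₂ ℤ._<_ (+-* a (suc l)) (+-* b (suc k)) lt′)

AllPairs-map-within : ∀ {P : ℕ → Set} {R S : ℕ → ℕ → Set} {f : ℕ → ℕ} →
                      (∀ {x y} → P x → P y → R x y → S (f x) (f y)) →
                      ∀ {xs} → All P xs → AllPairs R xs → AllPairs S (map f xs)
AllPairs-map-within mono []         []         = []
AllPairs-map-within mono (px ∷ pxs) (rx ∷ rxs) =
  All.map⁺ (All.zipWith (λ (py , r) → mono px py r) (pxs , rx)) ∷ AllPairs-map-within mono pxs rxs

length-take≤ : ∀ {A : Set} n (xs : List A) → length (take n xs) ≤ n
length-take≤ n xs = subst (_≤ n) (sym (List.length-take n xs)) (ℕ.m⊓n≤m n (length xs))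

module _ {P : Pred ℕ 0ℓ} (P? : Decidable P) where

  filter-downFrom-+ : ∀ k n → (∀ {i} → n ≤ i → ¬ P i) →
                      filter P? (downFrom (k + n)) ≡ filter P? (downFrom n)
  filter-downFrom-+ zero    n ¬P = refl
  filter-downFrom-+ (suc k) n ¬P =
    trans (List.filter-reject P? (¬P (ℕ.m≤n+m n k))) (filter-downFrom-+ k n ¬P)

  filter-applyUpTo-+ : ∀ f k n → (∀ {i} → i < k → ¬ P (f i)) →
                       filter P? (applyUpTo f (k + n)) ≡ filter P? (applyUpTo (λ i → f (k + i)) n)
  filter-applyUpTo-+ f zero    n ¬P = refl
  filter-applyUpTo-+ f (suc k) n ¬P =
    trans (List.filter-reject P? (¬P (s≤s z≤n))) (filter-applyUpTo-+ (f ∘ suc) k n (¬P ∘ s≤s))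

prime⇒¬∣ : ∀ {p} q .{{_ : NonTrivial q}} → Prime p → q < p → ¬ q ∣ p
prime⇒¬∣ q p-prime q<p q∣p = prime⇒¬composite p-prime (hasNonTrivialDivisor q<p q∣p)

trialDivisionFrom? : ∀ n .{{_ : NonTrivial n}} (fuel k : ℕ) → (2 + k) Rough n → Dec (Prime n)
trialDivisionFrom? n zero       k rough = prime? n
trialDivisionFrom? n (suc fuel) k rough with n ℕ.<? (2 + k) * (2 + k)
... | yes n<d² = yes (rough∧square>⇒prime rough n<d²)
... | no  n≮d² with (2 + k) ∣? n
...   | yes d∣n = no λ n-prime → prime⇒¬∣ (2 + k) n-prime d<n d∣n
  where
  d<n : 2 + k < n
  d<n = ℕ.<-≤-trans (ℕ.m<m*n (2 + k) (2 + k) (s≤s (s≤s z≤n))) (ℕ.≮⇒≥ n≮d²)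
...   | no  d∤n = trialDivisionFrom? n fuel (suc k) (∤⇒rough-suc d∤n rough)

-- The fuel n is never exhausted: the search stops once (2 + k)² > n.
trialDivision? : Decidable Prime
trialDivision? 0                = prime? 0
trialDivision? 1                = prime? 1
trialDivision? n@(suc (suc _)) = trialDivisionFrom? n n 0 2-rough

half : ℕ → ℚ
half m = + (2 * m + 1) ℚ./ 2

weight : ℕ → ℚ
weight e = + 2 ℚ./ suc (2 * e)

weight-antitone : ∀ {c e} → c ≤ e → weight e ℚ.≤ weight c
weight-antitone {c} {e} c≤e = /≤/ 2 2 (2 * e) (2 * c) (ℕ.*-monoʳ-≤ 2 (s≤s (ℕ.*-monoʳ-≤ 2 c≤e)))

weight-nonNeg : ∀ e → 0ℚ ℚ.≤ weight e
weight-nonNeg e = /≤/ 0 2 0 (2 * e) z≤n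

recip-unique : ∀ q r → q ℚ.* r ≡ 1ℚ → recip q ≡ r
recip-unique q r qr≡1 with q ℚ.≟ 0ℚ
... | yes refl with () ← trans (sym (ℚ.*-zeroˡ r)) qr≡1
... | no q≢0 = begin
  1/q                 ≡⟨ ℚ.*-identityʳ 1/q ⟨
  1/q ℚ.* 1ℚ          ≡⟨ cong (1/q ℚ.*_) qr≡1 ⟨
  1/q ℚ.* (q ℚ.* r)   ≡⟨ ℚ.*-assoc 1/q q r ⟨
  (1/q ℚ.* q) ℚ.* r   ≡⟨ cong (ℚ._* r) (ℚ.*-inverseˡ q {{ℚ.≢-nonZero q≢0}}) ⟩
  1ℚ ℚ.* r            ≡⟨ ℚ.*-identityˡ r ⟩
  r                   ∎
  where
  open ≡-Reasoning
  1/q : ℚ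
  1/q = 1/_ q {{ℚ.≢-nonZero q≢0}}

recip-half : ∀ e → recip (half e) ≡ weight e
recip-half e = recip-unique (half e) (weight e)
  (trans (/*/ (2 * e + 1) 2 1 (2 * e)) (/≡/ ((2 * e + 1) * 2) 1 (2 * e + 1 * suc (2 * e)) 0 (arith e)))
  where
  arith : ∀ e → (2 * e + 1) * 2 * 1 ≡ 1 * (2 * suc (2 * e))
  arith = solve-∀

half-+ˡ : ∀ p e → half (p + e) ≡ ℕ→ℚ p ℚ.+ half e
half-+ˡ p e = sym (trans (/+/ p (2 * e + 1) 0 1)
  (/≡/ (p * 2 + (2 * e + 1) * 1) (2 * (p + e) + 1) 1 1 (arith p e)))
  where
  arith : ∀ p e → (p * 2 + (2 * e + 1) * 1) * 2 ≡ (2 * (p + e) + 1) * (1 * 2)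
  arith = solve-∀

half-+ʳ : ∀ m e → ℕ→ℚ (m + suc e) ≡ half m ℚ.+ half e
half-+ʳ m e = sym (trans (/+/ (2 * m + 1) (2 * e + 1) 1 1)
  (/≡/ ((2 * m + 1) * 2 + (2 * e + 1) * 2) (m + suc e) 3 0 (arith m e)))
  where
  arith : ∀ m e → ((2 * m + 1) * 2 + (2 * e + 1) * 2) * 1 ≡ (m + suc e) * (2 * 2)
  arith = solve-∀

recip-half-∸ : ∀ p e → recip (half (p + e) ℚ.- ℕ→ℚ p) ≡ weight e
recip-half-∸ p e = begin
  recip (half (p + e) ℚ.- ℕ→ℚ p)       ≡⟨ cong (λ y → recip (y ℚ.- ℕ→ℚ p)) (half-+ˡ p e) ⟩
  recip (ℕ→ℚ p ℚ.+ half e ℚ.- ℕ→ℚ p)   ≡⟨ cong recip (xyx⁻¹≈y ℚ.+-0-abelianGroup (ℕ→ℚ p) (half e)) ⟩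
  recip (half e)                       ≡⟨ recip-half e ⟩
  weight e                             ∎
  where open ≡-Reasoning

recip-∸-half : ∀ m e → recip (ℕ→ℚ (m + suc e) ℚ.- half m) ≡ weight e
recip-∸-half m e = begin
  recip (ℕ→ℚ (m + suc e) ℚ.- half m)     ≡⟨ cong (λ y → recip (y ℚ.- half m)) (half-+ʳ m e) ⟩
  recip (half m ℚ.+ half e ℚ.- half m)   ≡⟨ cong recip (xyx⁻¹≈y ℚ.+-0-abelianGroup (half m) (half e)) ⟩
  recip (half e)                         ≡⟨ recip-half e ⟩
  weight e                               ∎
  where open ≡-Reasoning

-- Greedy bound for sums over admissible gaps

module _ (admissible : ℕ → Bool) where

  firstAdmissibleFrom : ℕ → ℕ → ℕ
  firstAdmissibleFrom zero    c = c
  firstAdmissibleFrom (suc n) c = if admissible c then c else firstAdmissibleFrom n (suc c)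

  inadmissible-before-first : ∀ n {c e} → c ≤ e → e < firstAdmissibleFrom n c → ¬ T (admissible e)
  inadmissible-before-first zero    c≤e e<c = contradiction c≤e (ℕ.<⇒≱ e<c)
  inadmissible-before-first (suc n) {c} c≤e e<first with admissible c in eq
  ... | true  = contradiction c≤e (ℕ.<⇒≱ e<first)
  ... | false with ℕ.m≤n⇒m<n∨m≡n c≤e
  ...   | inj₂ refl = subst T eq
  ...   | inj₁ c<e  = inadmissible-before-first n c<e e<first

  firstAdmissibleFrom-≤ : ∀ n {c e} → c ≤ e → T (admissible e) → firstAdmissibleFrom n c ≤ e
  firstAdmissibleFrom-≤ n c≤e adm = ℕ.≮⇒≥ λ e<first → inadmissible-before-first n c≤e e<first adm

  greedySum : (ℕ → ℚ) → ℕ → ℕ → ℕ → ℚ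
  greedySum w n c zero    = 0ℚ
  greedySum w n c (suc k) = w e ℚ.+ greedySum w n (suc e) k
    where
    e : ℕ
    e = firstAdmissibleFrom n c

  module _ (w : ℕ → ℚ) (w-antitone : ∀ {c e} → c ≤ e → w e ℚ.≤ w c) (w-nonNeg : ∀ e → 0ℚ ℚ.≤ w e)
           (n : ℕ) where

    greedySum-nonNeg : ∀ c k → 0ℚ ℚ.≤ greedySum w n c k
    greedySum-nonNeg c zero    = ℚ.≤-refl
    greedySum-nonNeg c (suc k) = ℚ.+-mono-≤ (w-nonNeg _) (greedySum-nonNeg _ k)

    sum≤greedySum : ∀ k c {es} → All (T ∘ admissible) es → All (c ≤_) es → AllPairs _<_ es →
                    length es ≤ k → sumℚ (map w es) ℚ.≤ greedySum w n c k
    sum≤greedySum k       c {[]}     _ _ _ _ = greedySum-nonNeg c k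
    sum≤greedySum (suc k) c {e ∷ es} (adm ∷ adms) (c≤e ∷ _) (e<es ∷ sorted) (s≤s len) =
      ℚ.+-mono-≤ (w-antitone first≤e)
                 (sum≤greedySum k (suc first) adms (All.map (ℕ.≤-<-trans first≤e) e<es) sorted len)
      where
      first : ℕ
      first = firstAdmissibleFrom n c
      first≤e : first ≤ e
      first≤e = firstAdmissibleFrom-≤ n c≤e adm

-- Sieving the gaps by 2, 3, 5 and 7

[m+n]%d≡n%d⇒d∣m : ∀ m n d .{{_ : NonZero d}} → (m + n) % d ≡ n % d → d ∣ m
[m+n]%d≡n%d⇒d∣m m n d eq = ∣m+n∣m⇒∣n d∣[n/d]*d+m (n∣m*n (n / d))
  where
  r : ℕ
  r = n % d
  arith : ∀ m r s → m + (r + s) ≡ r + (s + m)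
  arith = solve-∀
  split : r + ((n / d) * d + m) ≡ r + ((m + n) / d) * d
  split = begin
    r + ((n / d) * d + m)            ≡⟨ arith m r ((n / d) * d) ⟨
    m + (r + (n / d) * d)            ≡⟨ cong (λ z → m + z) (m≡m%n+[m/n]*n n d) ⟨
    m + n                            ≡⟨ m≡m%n+[m/n]*n (m + n) d ⟩
    (m + n) % d + ((m + n) / d) * d  ≡⟨ cong (_+ ((m + n) / d) * d) eq ⟩
    r + ((m + n) / d) * d            ∎
    where open ≡-Reasoning
  d∣[n/d]*d+m : d ∣ (n / d) * d + m
  d∣[n/d]*d+m = subst (d ∣_) (sym (ℕ.+-cancelˡ-≡ r _ _ split)) (n∣m*n ((m + n) / d))

%-congˡ-+ : ∀ {a b} k d .{{_ : NonZero d}} → a % d ≡ b % d → (a + k) % d ≡ (b + k) % d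
%-congˡ-+ {a} {b} k d eq = begin
  (a + k) % d              ≡⟨ %-distribˡ-+ a k d ⟩
  (a % d + k % d) % d      ≡⟨ cong (λ z → (z + k % d) % d) eq ⟩
  (b % d + k % d) % d      ≡⟨ %-distribˡ-+ b k d ⟨
  (b + k) % d              ∎
  where open ≡-Reasoning

incongruent : (q : ℕ) .{{_ : NonZero q}} → ℕ → ℕ → Bool
incongruent q a b = isNo (a % q ℕ.≟ b % q)

-- For m ≡ r (mod 210), admissibleᴸ r e fails when m ∸ e, the candidate prime at gap e below
-- x = m + 1/2, has a factor 2, 3, 5 or 7; admissibleᵁ r e fails when m + suc e, the candidate
-- above x, has one.
admissibleᴸ : ℕ → ℕ → Bool
admissibleᴸ r e = incongruent 2 e r ∧ incongruent 3 e r ∧ incongruent 5 e r ∧ incongruent 7 e r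

admissibleᵁ : ℕ → ℕ → Bool
admissibleᵁ r e = incongruent 2 (r + suc e) 0 ∧ incongruent 3 (r + suc e) 0
                ∧ incongruent 5 (r + suc e) 0 ∧ incongruent 7 (r + suc e) 0

module _ {m p e : ℕ} (p-prime : Prime p) (8≤p : 8 ≤ p) where

  private
    ∧-intro : ∀ {a b} → T a → T b → T (a ∧ b)
    ∧-intro ta tb = Equivalence.from T-∧ (ta , tb)

    module _ (q : ℕ) .{{_ : NonZero q}} .{{_ : NonTrivial q}} (q∣210 : q ∣ 210) (q≤7 : q ≤ 7) where

      r%q≡m%q : m % 210 % q ≡ m % q
      r%q≡m%q = m∣n⇒o%n%m≡o%m q 210 m q∣210

      q∤p : ¬ q ∣ p
      q∤p = prime⇒¬∣ q p-prime (ℕ.≤-<-trans q≤7 8≤p)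

      incongruentᴸ : p + e ≡ m → T (incongruent q e (m % 210))
      incongruentᴸ p+e≡m = fromWitnessFalse λ e≡r → q∤p ([m+n]%d≡n%d⇒d∣m p e q (begin
        (p + e) % q      ≡⟨ cong (_% q) p+e≡m ⟩
        m % q            ≡⟨ r%q≡m%q ⟨
        m % 210 % q      ≡⟨ e≡r ⟨
        e % q            ∎))
        where open ≡-Reasoning

      incongruentᵁ : m + suc e ≡ p → T (incongruent q (m % 210 + suc e) 0)
      incongruentᵁ m+e≡p = fromWitnessFalse λ r+e≡0 → q∤p (m%n≡0⇒n∣m p q (begin
        p % q                  ≡⟨ cong (_% q) m+e≡p ⟨
        (m + suc e) % q        ≡⟨ %-congˡ-+ (suc e) q r%q≡m%q ⟨
        (m % 210 + suc e) % q  ≡⟨ r+e≡0 ⟩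
        0 % q                  ≡⟨ m*n%n≡0 0 q ⟩
        0                      ∎))
        where open ≡-Reasoning

  admissibleᴸ-sound : p + e ≡ m → T (admissibleᴸ (m % 210) e)
  admissibleᴸ-sound eq =
    ∧-intro (incongruentᴸ 2 (divides 105 refl) (ℕ.m≤m+n 2 5) eq)
    (∧-intro (incongruentᴸ 3 (divides 70 refl) (ℕ.m≤m+n 3 4) eq)
    (∧-intro (incongruentᴸ 5 (divides 42 refl) (ℕ.m≤m+n 5 2) eq)
             (incongruentᴸ 7 (divides 30 refl) ℕ.≤-refl eq)))

  admissibleᵁ-sound : m + suc e ≡ p → T (admissibleᵁ (m % 210) e)
  admissibleᵁ-sound eq =
    ∧-intro (incongruentᵁ 2 (divides 105 refl) (ℕ.m≤m+n 2 5) eq)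
    (∧-intro (incongruentᵁ 3 (divides 70 refl) (ℕ.m≤m+n 3 4) eq)
    (∧-intro (incongruentᵁ 5 (divides 42 refl) (ℕ.m≤m+n 5 2) eq)
             (incongruentᵁ 7 (divides 30 refl) ℕ.≤-refl eq)))

-- Bounding F₁ and F₂ at x = m + 1/2 for m ≥ 14

-- 10 is the Jacobsthal number of 210 (any 10 consecutive integers contain one coprime to 210),
-- so a search window of 10 always reaches the next admissible gap; soundness does not depend on it.
greedyBound : (ℕ → Bool) → ℚ
greedyBound admissible = greedySum admissible weight 10 0 8

sum≤greedyBound : ∀ admissible {es} → All (T ∘ admissible) es → AllPairs _<_ es → length es ≤ 8 →
                  sumℚ (map weight es) ℚ.≤ greedyBound admissible
sum≤greedyBound admissible adms sorted len =
  sum≤greedySum admissible weight weight-antitone weight-nonNeg 10 8 0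
                adms (All.universal (λ _ → z≤n) _) sorted len

LowerWindow : ℚ → ℕ → Set
LowerWindow x p = Prime p × x ℚ.* (+ 1 ℚ./ 2) ℚ.< ℕ→ℚ p × ℕ→ℚ p ℚ.< x

UpperWindow : ℚ → ℕ → Set
UpperWindow x p = Prime p × x ℚ.< ℕ→ℚ p × ℕ→ℚ p ℚ.< x ℚ.* (+ 3 ℚ./ 2)

lowerWindow? : Decidable Prime → (x : ℚ) → Decidable (LowerWindow x)
lowerWindow? primality? x p = primality? p ×-dec (x ℚ.* (+ 1 ℚ./ 2)) ℚ.<? ℕ→ℚ p ×-dec ℕ→ℚ p ℚ.<? x

upperWindow? : Decidable Prime → (x : ℚ) → Decidable (UpperWindow x)
upperWindow? primality? x p = primality? p ×-dec x ℚ.<? ℕ→ℚ p ×-dec ℕ→ℚ p ℚ.<? (x ℚ.* (+ 3 ℚ./ 2))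

primesLowerDesc-window : ∀ x → All (LowerWindow x) (primesLowerDesc x)
primesLowerDesc-window x = All.all-filter (lowerWindow? prime? x) (downFrom (suc (bound x)))

primesLowerDesc-descending : ∀ x → AllPairs _>_ (primesLowerDesc x)
primesLowerDesc-descending x = AllPairs.filter⁺ (lowerWindow? prime? x)
  (AllPairs.applyDownFrom⁺₁ id (suc (bound x)) (λ j<i _ → j<i))

primesUpperAsc-window : ∀ x → All (UpperWindow x) (primesUpperAsc x)
primesUpperAsc-window x = All.all-filter (upperWindow? prime? x) (applyUpTo id (suc (bound x)))

primesUpperAsc-ascending : ∀ x → AllPairs _<_ (primesUpperAsc x)
primesUpperAsc-ascending x = AllPairs.filter⁺ (upperWindow? prime? x)
  (AllPairs.applyUpTo⁺₁ id (suc (bound x)) (λ i<j _ → i<j))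

private
  2m+1≡1+m*2 : ∀ m → (2 * m + 1) * 1 ≡ suc (m * 2)
  2m+1≡1+m*2 = solve-∀

<half⇒≤ : ∀ {m p} → ℕ→ℚ p ℚ.< half m → p ≤ m
<half⇒≤ {m} {p} p<x = ℕ.*-cancelʳ-≤ p m 2
  (ℕ.≤-pred (subst (suc (p * 2) ≤_) (2m+1≡1+m*2 m) (/</⁻¹ p (2 * m + 1) 0 1 p<x)))

half<⇒< : ∀ {m p} → half m ℚ.< ℕ→ℚ p → m < p
half<⇒< {m} {p} x<p = ℕ.*-cancelʳ-< 2 m p
  (ℕ.<-trans (ℕ.n<1+n (m * 2)) (subst (_< p * 2) (2m+1≡1+m*2 m) (/</⁻¹ (2 * m + 1) p 1 0 x<p)))

half/2<⇒8≤ : ∀ {m p} → 14 ≤ m → half m ℚ.* (+ 1 ℚ./ 2) ℚ.< ℕ→ℚ p → 8 ≤ p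
half/2<⇒8≤ {m} {p} 14≤m x/2<p = ℕ.*-cancelʳ-< 4 7 p (ℕ.<-trans 28<2m+1 2m+1<p*4)
  where
  2m+1<p*4 : (2 * m + 1) * 1 * 1 < p * 4
  2m+1<p*4 = /</⁻¹ ((2 * m + 1) * 1) p 3 0 (subst (ℚ._< ℕ→ℚ p) (/*/ (2 * m + 1) 1 1 1) x/2<p)
  28<2m+1 : 28 < (2 * m + 1) * 1 * 1
  28<2m+1 = subst (28 <_) (sym (arith m)) (s≤s (ℕ.*-monoˡ-≤ 2 14≤m))
    where
    arith : ∀ m → (2 * m + 1) * 1 * 1 ≡ suc (m * 2)
    arith = solve-∀

F₁-half≤greedyBound : ∀ m → 14 ≤ m → F₁ (half m) ℚ.≤ greedyBound (admissibleᴸ (m % 210))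
F₁-half≤greedyBound m 14≤m = begin
  F₁ (half m)                          ≡⟨ cong sumℚ terms≡weights ⟩
  sumℚ (map weight (map (m ∸_) ps))    ≤⟨ sum≤greedyBound (admissibleᴸ (m % 210)) admissible ascending length≤8 ⟩
  greedyBound (admissibleᴸ (m % 210))  ∎
  where
  open ℚ.≤-Reasoning
  ps : List ℕ
  ps = take 8 (primesLowerDesc (half m))
  bounds : All (λ p → Prime p × p ≤ m × 8 ≤ p) ps
  bounds = All.map (λ (p-prime , x/2<p , p<x) → p-prime , <half⇒≤ p<x , half/2<⇒8≤ 14≤m x/2<p)
                   (All.take⁺ 8 (primesLowerDesc-window (half m)))
  terms≡weights : map (λ p → recip (half m ℚ.- ℕ→ℚ p)) ps ≡ map weight (map (m ∸_) ps)
  terms≡weights = trans (List.map-cong-local (All.map (λ (_ , p≤m , _) → term≡weight p≤m) bounds))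
                        (List.map-∘ ps)
    where
    term≡weight : ∀ {p} → p ≤ m → recip (half m ℚ.- ℕ→ℚ p) ≡ weight (m ∸ p)
    term≡weight {p} p≤m = subst (λ n → recip (half n ℚ.- ℕ→ℚ p) ≡ weight (m ∸ p))
                                (ℕ.m+[n∸m]≡n p≤m) (recip-half-∸ p (m ∸ p))
  admissible : All (T ∘ admissibleᴸ (m % 210)) (map (m ∸_) ps)
  admissible = All.map⁺ (All.map (λ (p-prime , p≤m , 8≤p) →
                 admissibleᴸ-sound p-prime 8≤p (ℕ.m+[n∸m]≡n p≤m)) bounds)
  ascending : AllPairs _<_ (map (m ∸_) ps)
  ascending = AllPairs-map-within (λ (_ , p≤m , _) _ q<p → ℕ.∸-monoʳ-< q<p p≤m) bounds
                (AllPairs.take⁺ 8 (primesLowerDesc-descending (half m)))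
  length≤8 : length (map (m ∸_) ps) ≤ 8
  length≤8 = subst (_≤ 8) (sym (List.length-map (m ∸_) ps)) (length-take≤ 8 (primesLowerDesc (half m)))

F₂-half≤greedyBound : ∀ m → 14 ≤ m → F₂ (half m) ℚ.≤ greedyBound (admissibleᵁ (m % 210))
F₂-half≤greedyBound m 14≤m = begin
  F₂ (half m)                              ≡⟨ cong sumℚ terms≡weights ⟩
  sumℚ (map weight (map (_∸ suc m) ps))    ≤⟨ sum≤greedyBound (admissibleᵁ (m % 210)) admissible ascending length≤8 ⟩
  greedyBound (admissibleᵁ (m % 210))      ∎
  where
  open ℚ.≤-Reasoning
  ps : List ℕ
  ps = take 8 (primesUpperAsc (half m))
  bounds : All (λ p → Prime p × m < p × 8 ≤ p) ps
  bounds = All.map (λ (p-prime , x<p , _) → p-prime , half<⇒< x<p , 8≤ (half<⇒< x<p))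
                   (All.take⁺ 8 (primesUpperAsc-window (half m)))
    where
    8≤ : ∀ {p} → m < p → 8 ≤ p
    8≤ m<p = ℕ.≤-trans (ℕ.m≤n+m 8 6) (ℕ.≤-trans 14≤m (ℕ.<⇒≤ m<p))
  m+[p∸m]≡p : ∀ {p} → m < p → m + suc (p ∸ suc m) ≡ p
  m+[p∸m]≡p m<p = trans (ℕ.+-suc _ _) (ℕ.m+[n∸m]≡n m<p)
  terms≡weights : map (λ p → recip (ℕ→ℚ p ℚ.- half m)) ps ≡ map weight (map (_∸ suc m) ps)
  terms≡weights = trans (List.map-cong-local (All.map (λ (_ , m<p , _) → term≡weight m<p) bounds))
                        (List.map-∘ ps)
    where
    term≡weight : ∀ {p} → m < p → recip (ℕ→ℚ p ℚ.- half m) ≡ weight (p ∸ suc m)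
    term≡weight {p} m<p = subst (λ n → recip (ℕ→ℚ n ℚ.- half m) ≡ weight (p ∸ suc m))
                                (m+[p∸m]≡p m<p) (recip-∸-half m (p ∸ suc m))
  admissible : All (T ∘ admissibleᵁ (m % 210)) (map (_∸ suc m) ps)
  admissible = All.map⁺ (All.map (λ (p-prime , m<p , 8≤p) →
                 admissibleᵁ-sound p-prime 8≤p (m+[p∸m]≡p m<p)) bounds)
  ascending : AllPairs _<_ (map (_∸ suc m) ps)
  ascending = AllPairs-map-within (λ (_ , m<p , _) _ p<q → ℕ.∸-monoˡ-< p<q m<p) bounds
                (AllPairs.take⁺ 8 (primesUpperAsc-ascending (half m)))
  length≤8 : length (map (_∸ suc m) ps) ≤ 8
  length≤8 = subst (_≤ 8) (sym (List.length-map (_∸ suc m) ps)) (length-take≤ 8 (primesUpperAsc (half m)))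

greedyBoundᴸ≤C : ∀ {r} → r < 210 → greedyBound (admissibleᴸ r) ℚ.≤ C
greedyBoundᴸ≤C = from-yes (ℕ.allUpTo? (λ r → greedyBound (admissibleᴸ r) ℚ.≤? C) 210)

greedyBoundᵁ≤C : ∀ {r} → r < 210 → greedyBound (admissibleᵁ r) ℚ.≤ C
greedyBoundᵁ≤C = from-yes (ℕ.allUpTo? (λ r → greedyBound (admissibleᵁ r) ℚ.≤? C) 210)

F₁-half≤C-small : ∀ {m} → m < 14 → F₁ (half m) ℚ.≤ C
F₁-half≤C-small = from-yes (ℕ.allUpTo? (λ m → F₁ (half m) ℚ.≤? C) 14)

F₂-half≤C-small : ∀ {m} → m < 14 → F₂ (half m) ℚ.≤ C
F₂-half≤C-small = from-yes (ℕ.allUpTo? (λ m → F₂ (half m) ℚ.≤? C) 14)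

F₁-half≤C : ∀ m → F₁ (half m) ℚ.≤ C
F₁-half≤C m = [ F₁-half≤C-small
              , (λ 14≤m → ℚ.≤-trans (F₁-half≤greedyBound m 14≤m) (greedyBoundᴸ≤C (m%n<n m 210))) ]′
              (ℕ.<-≤-connex m 14)

F₂-half≤C : ∀ m → F₂ (half m) ℚ.≤ C
F₂-half≤C m = [ F₂-half≤C-small
              , (λ 14≤m → ℚ.≤-trans (F₂-half≤greedyBound m 14≤m) (greedyBoundᵁ≤C (m%n<n m 210))) ]′
              (ℕ.<-≤-connex m 14)

-- Sharpness

-- Stated for an arbitrary x: at a concrete x, checking F₁ x against the right-hand side would
-- make Agda evaluate the slow test prime? on every number above x.
F₁-via-trialDivision : ∀ x k n → suc (bound x) ≡ k + n → (∀ {p} → n ≤ p → ¬ LowerWindow x p) →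
  F₁ x ≡ sumℚ (map (λ p → recip (x ℚ.- ℕ→ℚ p)) (take 8 (filter (lowerWindow? trialDivision? x) (downFrom n))))
F₁-via-trialDivision x k n bound≡ ¬window = cong (λ ps → sumℚ (map (λ p → recip (x ℚ.- ℕ→ℚ p)) (take 8 ps)))
  (begin
    filter P? (downFrom (suc (bound x)))  ≡⟨ cong (filter P? ∘ downFrom) bound≡ ⟩
    filter P? (downFrom (k + n))          ≡⟨ filter-downFrom-+ P? k n ¬window ⟩
    filter P? (downFrom n)                ≡⟨ List.filter-≐ P? Q? (id , id) (downFrom n) ⟩
    filter Q? (downFrom n)                ∎)
  where
  open ≡-Reasoning
  P? Q? : Decidable (LowerWindow x)
  P? = lowerWindow? prime? x
  Q? = lowerWindow? trialDivision? x

F₂-via-trialDivision : ∀ x k n → suc (bound x) ≡ k + n → (∀ {p} → p < k → ¬ UpperWindow x p) →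
  F₂ x ≡ sumℚ (map (λ p → recip (ℕ→ℚ p ℚ.- x))
                   (take 8 (filter (upperWindow? trialDivision? x) (applyUpTo (λ i → k + i) n))))
F₂-via-trialDivision x k n bound≡ ¬window = cong (λ ps → sumℚ (map (λ p → recip (ℕ→ℚ p ℚ.- x)) (take 8 ps)))
  (begin
    filter P? (applyUpTo id (suc (bound x)))   ≡⟨ cong (filter P? ∘ applyUpTo id) bound≡ ⟩
    filter P? (applyUpTo id (k + n))           ≡⟨ filter-applyUpTo-+ P? id k n ¬window ⟩
    filter P? (applyUpTo (λ i → k + i) n)      ≡⟨ List.filter-≐ P? Q? (id , id) (applyUpTo (λ i → k + i) n) ⟩
    filter Q? (applyUpTo (λ i → k + i) n)      ∎)
  where
  open ≡-Reasoning
  P? Q? : Decidable (UpperWindow x)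
  P? = upperWindow? prime? x
  Q? = upperWindow? trialDivision? x

F₁-sharp : F₁ (half 88819) ≡ C
F₁-sharp = trans (F₁-via-trialDivision (half 88819) 88820 88820 refl ¬window) refl
  where
  ¬window : ∀ {p} → 88820 ≤ p → ¬ LowerWindow (half 88819) p
  ¬window 88820≤p (_ , _ , p<x) = ℕ.<⇒≱ (s≤s (<half⇒≤ {88819} p<x)) 88820≤p

F₂-sharp : F₂ (half 15760090) ≡ C
F₂-sharp = trans (F₂-via-trialDivision (half 15760090) 15760091 15760091 refl ¬window) refl
  where
  ¬window : ∀ {p} → p < 15760091 → ¬ UpperWindow (half 15760090) p
  ¬window p<k (_ , x<p , _) = ℕ.<⇒≱ p<k (half<⇒< {15760090} x<p)

lemma2p4 : (((x : ℚ) → HalfInteger x → F₁ x ℚ.≤ C) × (∃[ x ] (HalfInteger x × F₁ x ≡ C)))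
         × (((x : ℚ) → HalfInteger x → F₂ x ℚ.≤ C) × (∃[ x ] (HalfInteger x × F₂ x ≡ C)))
lemma2p4 = ( (λ { x (m , _ , refl) → F₁-half≤C m }) , half 88819 , (88819 , s≤s z≤n , refl) , F₁-sharp )
         , ( (λ { x (m , _ , refl) → F₂-half≤C m }) , half 15760090 , (15760090 , s≤s z≤n , refl) , F₂-sharp )
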